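{- There exists an absolute constant $C'>0$ such that the following holds. Let $0<\delta<1/2$, let $t$ be a positive integer, and let the edges of $K_n$ be coloured red and blue such that there are no two disjoint vertex sets $P,Q$ of size $t$ with all edges between $P$ and $Q$ red and all edges inside $P$ and inside $Q$ blue (i.e. the red edges do not induce a $K_{t,t}$). Let $A,B$ be disjoint vertex sets, each containing no red clique on $t$ vertices, with $|A|,|B|\ge \delta^{ -C't}$. Then $e_r(A,B)\le \delta^{20}|A||B|$.
   Context: $e_r(A,B)$ denotes the number of red edges with one endpoint in $A$ and the other in $B$. A red clique is a set of vertices all of whose internal edges are red.
   Formalization: The parameter δ ranges only over rational values with $0<\delta<1/2$. -}

module Defs where

open import Data.Nat as ℕ using (ℕ; zero; suc)
open import Data.Integer using (+_)
open import Data.Rational using (ℚ; 1ℚ; _*_; _/_)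
open import Data.Bool using (Bool; true; false; if_then_else_; _∧_)
open import Data.Fin using (Fin)
open import Data.Fin.Subset using (Subset; _∈_; _⊆_; ∣_∣)
open import Data.Fin.Subset.Properties using (_∈?_)
open import Data.List using (List; map; allFin)
open import Data.Nat.ListAction using (sum)
open import Data.Product using (Σ; _×_; ∃-syntax)
open import Data.Empty using (⊥)
open import Relation.Nullary using (¬_; Dec; yes; no)
open import Relation.Nullary.Decidable using (⌊_⌋)
open import Relation.Binary.PropositionalEquality using (_≡_; _≢_)

ℕtoℚ : ℕ → ℚ
ℕtoℚ n = + n / 1

_^ℚ_ : ℚ → ℕ → ℚ
q ^ℚ zero = 1ℚ
q ^ℚ suc k = q * (q ^ℚ k)

-- A red/blue colouring of the edges of K_n: red x y ≡ true means the edge xy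
-- is red, false means blue. Only values at x ≢ y matter; symmetry is required.
Colouring : ℕ → Set
Colouring n = Fin n → Fin n → Bool

Symmetric : ∀ {n} → Colouring n → Set
Symmetric {n} red = ∀ (x y : Fin n) → red x y ≡ red y x

DisjointSets : ∀ {n} → Subset n → Subset n → Set
DisjointSets {n} P Q = ∀ (x : Fin n) → x ∈ P → x ∈ Q → ⊥

RedClique : ∀ {n} → Colouring n → Subset n → Set
RedClique {n} red K = ∀ (x y : Fin n) → x ∈ K → y ∈ K → x ≢ y → red x y ≡ true

BlueClique : ∀ {n} → Colouring n → Subset n → Set
BlueClique {n} red K = ∀ (x y : Fin n) → x ∈ K → y ∈ K → x ≢ y → red x y ≡ false

AllRedBetween : ∀ {n} → Colouring n → Subset n → Subset n → Set
AllRedBetween {n} red P Q = ∀ (x y : Fin n) → x ∈ P → y ∈ Q → red x y ≡ true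

HasInducedRedKtt : ∀ {n} → Colouring n → ℕ → Set
HasInducedRedKtt {n} red t =
  ∃[ P ] ∃[ Q ] (DisjointSets {n} P Q × ∣ P ∣ ≡ t × ∣ Q ∣ ≡ t
                 × AllRedBetween red P Q × BlueClique red P × BlueClique red Q)

HasRedClique : ∀ {n} → Colouring n → Subset n → ℕ → Set
HasRedClique {n} red A t = ∃[ K ] (K ⊆ A × ∣ K ∣ ≡ t × RedClique red K)

-- e_r(A,B): number of pairs (a,b) with a ∈ A, b ∈ B and ab red
-- (for disjoint A, B this is the number of red edges between A and B)
eR : ∀ {n} → Colouring n → Subset n → Subset n → ℕ
eR {n} red A B =
  sum (map (λ a → sum (map (λ b →
        if ⌊ a ∈? A ⌋ ∧ ⌊ b ∈? B ⌋ ∧ red a b then 1 else 0) (allFin n))) (allFin n))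

module Submission where

-- Write δ²⁰ = p/q with p, q the 20th powers of the numerator and denominator of δ, so that
-- q ≥ 2²⁰ p. Suppose e_r(A,B) > (p/q)|A||B| with |B| ≤ |A|, and let Y′ ⊆ B be the vertices with
-- at least D = ⌊p|A|/2q⌋ red neighbours in A; they carry at least half of the red edges.
-- Dependent random choice, i.e. double counting over all 2t-tuples T in A, finds T whose common
-- red neighbourhood in Y′ still has more than m = 2^(2t) vertices after deleting one vertex from
-- every t-tuple whose common red neighbourhood in A has at most m vertices. Since
-- R(t,t) ≤ 2^(2t) and B has no red K_t, Ramsey gives a blue K_t on some Q in what is left; the
-- common red neighbourhood of Q in A is larger than m, and as A has no red K_t it contains a blue
-- K_t on some P. Then P and Q induce a red K_{t,t}.

open import Defs

module Combinatorics where

  open import Algebra.Bundles using (CommutativeMonoid)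
  open import Data.Bool using (Bool; true; false; _∧_; _∨_; not; if_then_else_)
  open import Data.Bool.Properties using (∧-conicalˡ; ∧-conicalʳ; ∧-commutativeMonoid)
  open import Algebra.Properties.CommutativeSemigroup (CommutativeMonoid.commutativeSemigroup ∧-commutativeMonoid)
    using () renaming (interchange to ∧-interchange)
  open import Data.Empty using (⊥-elim)
  open import Data.Fin using (Fin; zero; suc)
  open import Data.Fin.Properties using (_≟_)
  open import Data.Nat using (ℕ; zero; suc; _+_; _*_; _^_; _≤_; _<_; z≤n; s≤s; _<?_; _≤?_; _≡ᵇ_)
  open import Data.Nat.Properties hiding (_≟_)
  open import Data.Product using (Σ-syntax; ∃-syntax; _×_; _,_; proj₁)
  open import Data.Sum as Sum using (_⊎_; inj₁; inj₂)
  open import Data.Unit using (⊤; tt)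
  open import Data.Vec using (Vec; []; _∷_)
  open import Function using (_∘_)
  open import Relation.Binary.PropositionalEquality
  open import Relation.Nullary using (Dec; yes; no; does)
  open import Relation.Nullary.Decidable using (dec-true)
  open import Algebra.Properties.Semiring.Sum +-*-semiring
    using (sum; sum-cong-≗; ∑-distrib-+; ∑-comm; *-distribˡ-sum; *-distribʳ-sum; sum-replicate-zero)

  ⟦_⟧ : Bool → ℕ
  ⟦ b ⟧ = if b then 1 else 0

  ⟦∧⟧ : ∀ a b → ⟦ a ∧ b ⟧ ≡ ⟦ a ⟧ * ⟦ b ⟧
  ⟦∧⟧ true b = sym (+-identityʳ ⟦ b ⟧)
  ⟦∧⟧ false b = refl

  card : ∀ {n} → (Fin n → Bool) → ℕ
  card S = sum (⟦_⟧ ∘ S)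

  ∑-mono-≤ : ∀ {n} {f g : Fin n → ℕ} → (∀ i → f i ≤ g i) → sum f ≤ sum g
  ∑-mono-≤ {zero} f≤g = z≤n
  ∑-mono-≤ {suc n} f≤g = +-mono-≤ (f≤g zero) (∑-mono-≤ (f≤g ∘ suc))

  term≤∑ : ∀ {n} (f : Fin n → ℕ) i → f i ≤ sum f
  term≤∑ f zero = m≤m+n (f zero) _
  term≤∑ f (suc i) = ≤-trans (term≤∑ (f ∘ suc) i) (m≤n+m _ (f zero))

  ∑<∑⇒∃< : ∀ {n} (f g : Fin n → ℕ) → sum f < sum g → ∃[ i ] f i < g i
  ∑<∑⇒∃< {suc n} f g ∑f<∑g with f zero <? g zero
  ... | yes f₀<g₀ = zero , f₀<g₀
  ... | no f₀≮g₀ with ∑<∑⇒∃< (f ∘ suc) (g ∘ suc)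
         (+-cancelˡ-< (f zero) _ _ (<-≤-trans ∑f<∑g (+-monoˡ-≤ _ (≮⇒≥ f₀≮g₀))))
  ...   | i , fᵢ<gᵢ = suc i , fᵢ<gᵢ

  card-mono : ∀ {n} {S T : Fin n → Bool} → (∀ x → S x ≡ true → T x ≡ true) → card S ≤ card T
  card-mono {S = S} {T} S⊆T = ∑-mono-≤ pointwise
    where
    pointwise : ∀ x → ⟦ S x ⟧ ≤ ⟦ T x ⟧
    pointwise x with S x in Sx
    ... | false = z≤n
    ... | true rewrite S⊆T x Sx = ≤-refl

  card>0⇒∃ : ∀ {n} (S : Fin n → Bool) → 0 < card S → ∃[ x ] S x ≡ true
  card>0⇒∃ {n} S card>0
    with ∑<∑⇒∃< (λ _ → 0) (⟦_⟧ ∘ S) (subst (_< card S) (sym (sum-replicate-zero n)) card>0)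
  ... | x , 0<Sx with S x in Sx
  ...   | true = x , Sx

  card-≟ : ∀ {n} (v : Fin n) → card (does ∘ (v ≟_)) ≡ 1
  card-≟ {suc n} zero = cong suc (sum-replicate-zero n)
  card-≟ {suc n} (suc v) = card-≟ v

  card-≟′ : ∀ {n} (v : Fin n) → card (does ∘ (_≟ v)) ≡ 1
  card-≟′ {suc n} zero = cong suc (sum-replicate-zero n)
  card-≟′ {suc n} (suc v) = card-≟′ v

  pigeonhole : ∀ {a r b} → 2 * a ≤ suc (r + b) → r < a → a ≤ b
  pigeonhole {a} {r} {b} 2a≤1+r+b r<a = +-cancelˡ-≤ a a b (begin
    a + a      ≡⟨ cong (a +_) (+-identityʳ a) ⟨
    2 * a      ≤⟨ 2a≤1+r+b ⟩
    suc r + b  ≤⟨ +-monoˡ-≤ b r<a ⟩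
    a + b      ∎)
    where open ≤-Reasoning

  redDegree : ∀ {n} → Colouring n → (Fin n → Bool) → Fin n → ℕ
  redDegree red X w = card (λ x → X x ∧ red x w)

  ∑V : ∀ {n} k → (Vec (Fin n) k → ℕ) → ℕ
  ∑V zero F = F []
  ∑V (suc k) F = sum (λ x → ∑V k (F ∘ (x ∷_)))

  ∑V-cong : ∀ {n} k {F G : Vec (Fin n) k → ℕ} → (∀ v → F v ≡ G v) → ∑V k F ≡ ∑V k G
  ∑V-cong zero F≗G = F≗G []
  ∑V-cong (suc k) F≗G = sum-cong-≗ (λ x → ∑V-cong k (F≗G ∘ (x ∷_)))

  ∑V-mono-≤ : ∀ {n} k {F G : Vec (Fin n) k → ℕ} → (∀ v → F v ≤ G v) → ∑V k F ≤ ∑V k G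
  ∑V-mono-≤ zero F≤G = F≤G []
  ∑V-mono-≤ (suc k) F≤G = ∑-mono-≤ (λ x → ∑V-mono-≤ k (F≤G ∘ (x ∷_)))

  ∑V-distrib-+ : ∀ {n} k (F G : Vec (Fin n) k → ℕ) → ∑V k (λ v → F v + G v) ≡ ∑V k F + ∑V k G
  ∑V-distrib-+ zero F G = refl
  ∑V-distrib-+ (suc k) F G =
    trans (sum-cong-≗ (λ x → ∑V-distrib-+ k (F ∘ (x ∷_)) (G ∘ (x ∷_))))
          (∑-distrib-+ (λ x → ∑V k (F ∘ (x ∷_))) (λ x → ∑V k (G ∘ (x ∷_))))

  ∑V-*ˡ : ∀ {n} k c (F : Vec (Fin n) k → ℕ) → ∑V k (λ v → c * F v) ≡ c * ∑V k F
  ∑V-*ˡ zero c F = refl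
  ∑V-*ˡ (suc k) c F =
    trans (sum-cong-≗ (λ x → ∑V-*ˡ k c (F ∘ (x ∷_)))) (sym (*-distribˡ-sum c (λ x → ∑V k (F ∘ (x ∷_)))))

  ∑V-zero : ∀ {n} k → ∑V {n} k (λ _ → 0) ≡ 0
  ∑V-zero k = ∑V-*ˡ k 0 (λ _ → 0)

  ∑V-comm-∑ : ∀ {n m} k (F : Vec (Fin n) k → Fin m → ℕ) →
              ∑V k (λ v → sum (F v)) ≡ sum (λ j → ∑V k (λ v → F v j))
  ∑V-comm-∑ zero F = refl
  ∑V-comm-∑ (suc k) F =
    trans (sum-cong-≗ (λ x → ∑V-comm-∑ k (F ∘ (x ∷_)))) (∑-comm (λ x j → ∑V k (λ v → F (x ∷ v) j)))

  ∑V-comm : ∀ {n} k l (F : Vec (Fin n) k → Vec (Fin n) l → ℕ) →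
            ∑V k (λ v → ∑V l (F v)) ≡ ∑V l (λ w → ∑V k (λ v → F v w))
  ∑V-comm zero l F = refl
  ∑V-comm (suc k) l F =
    trans (sum-cong-≗ (λ x → ∑V-comm k l (F ∘ (x ∷_)))) (sym (∑V-comm-∑ l (λ w x → ∑V k (λ v → F (x ∷ v) w))))

  ∑V<∑V⇒∃< : ∀ {n} k (F G : Vec (Fin n) k → ℕ) → ∑V k F < ∑V k G → ∃[ v ] F v < G v
  ∑V<∑V⇒∃< zero F G F<G = [] , F<G
  ∑V<∑V⇒∃< (suc k) F G ∑F<∑G with ∑<∑⇒∃< _ _ ∑F<∑G
  ... | x , Fx<Gx with ∑V<∑V⇒∃< k (F ∘ (x ∷_)) (G ∘ (x ∷_)) Fx<Gx
  ...   | v , Fv<Gv = x ∷ v , Fv<Gv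

  term≤∑V : ∀ {n} k (F : Vec (Fin n) k → ℕ) v → F v ≤ ∑V k F
  term≤∑V zero F [] = ≤-refl
  term≤∑V (suc k) F (x ∷ v) = ≤-trans (term≤∑V k (F ∘ (x ∷_)) v) (term≤∑ (λ y → ∑V k (F ∘ (y ∷_))) x)

  allV : ∀ {A : Set} {k} → (A → Bool) → Vec A k → Bool
  allV S [] = true
  allV S (x ∷ xs) = S x ∧ allV S xs

  allV-true : ∀ {A : Set} {k} (xs : Vec A k) → allV (λ _ → true) xs ≡ true
  allV-true [] = refl
  allV-true (x ∷ xs) = allV-true xs

  allV-mono : ∀ {A : Set} {k} {S T : A → Bool} → (∀ x → S x ≡ true → T x ≡ true) →
              (xs : Vec A k) → allV S xs ≡ true → allV T xs ≡ true
  allV-mono S⊆T [] _ = refl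
  allV-mono {S = S} S⊆T (x ∷ xs) all rewrite S⊆T x (∧-conicalˡ (S x) _ all) =
    allV-mono S⊆T xs (∧-conicalʳ (S x) _ all)

  allV-∧ : ∀ {A : Set} {k} (S T : A → Bool) (xs : Vec A k) →
           allV (λ x → S x ∧ T x) xs ≡ allV S xs ∧ allV T xs
  allV-∧ S T [] = refl
  allV-∧ S T (x ∷ xs) = trans (cong ((S x ∧ T x) ∧_) (allV-∧ S T xs)) (∧-interchange (S x) (T x) _ _)

  allV-comm : ∀ {A B : Set} {k l} (S : A → Bool) (R : B → A → Bool) (ws : Vec A k) (xs : Vec B l) →
              allV (λ w → S w ∧ allV (λ x → R x w) xs) ws ≡ allV S ws ∧ allV (λ x → allV (R x) ws) xs
  allV-comm S R [] xs = sym (allV-true xs)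
  allV-comm S R (w ∷ ws) xs = begin
    (S w ∧ allV (λ x → R x w) xs) ∧ allV (λ w′ → S w′ ∧ allV (λ x → R x w′) xs) ws
      ≡⟨ cong ((S w ∧ allV (λ x → R x w) xs) ∧_) (allV-comm S R ws xs) ⟩
    (S w ∧ allV (λ x → R x w) xs) ∧ (allV S ws ∧ allV (λ x → allV (R x) ws) xs)
      ≡⟨ ∧-interchange (S w) _ _ _ ⟩
    (S w ∧ allV S ws) ∧ (allV (λ x → R x w) xs ∧ allV (λ x → allV (R x) ws) xs)
      ≡⟨ cong ((S w ∧ allV S ws) ∧_) (allV-∧ (λ x → R x w) (λ x → allV (R x) ws) xs) ⟨
    (S w ∧ allV S ws) ∧ allV (λ x → R x w ∧ allV (R x) ws) xs
      ∎
    where open ≡-Reasoning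

  ∑V-allV : ∀ {n} k (S : Fin n → Bool) → ∑V k (⟦_⟧ ∘ allV S) ≡ card S ^ k
  ∑V-allV zero S = refl
  ∑V-allV (suc k) S = begin
    sum (λ x → ∑V k (λ v → ⟦ S x ∧ allV S v ⟧))      ≡⟨ sum-cong-≗ (λ x → ∑V-cong k (λ v → ⟦∧⟧ (S x) (allV S v))) ⟩
    sum (λ x → ∑V k (λ v → ⟦ S x ⟧ * ⟦ allV S v ⟧))  ≡⟨ sum-cong-≗ (λ x → ∑V-*ˡ k ⟦ S x ⟧ (⟦_⟧ ∘ allV S)) ⟩
    sum (λ x → ⟦ S x ⟧ * ∑V k (⟦_⟧ ∘ allV S))        ≡⟨ sum-cong-≗ (λ x → cong (⟦ S x ⟧ *_) (∑V-allV k S)) ⟩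
    sum (λ x → ⟦ S x ⟧ * card S ^ k)                 ≡⟨ *-distribʳ-sum (card S ^ k) (⟦_⟧ ∘ S) ⟨
    card S * card S ^ k                              ∎
    where open ≡-Reasoning

  module Ramsey {n : ℕ} (red : Colouring n) where

    colour : Bool → Fin n → Fin n → Bool
    colour c x y = if c then red x y else not (red x y)

    entries : ∀ {k} → Vec (Fin n) k → Fin n → Bool
    entries [] y = false
    entries (x ∷ xs) y = does (x ≟ y) ∨ entries xs y

    Clique : ∀ {k} → Bool → Vec (Fin n) k → Set
    Clique c [] = ⊤
    Clique c (x ∷ xs) = entries xs x ≡ false × allV (colour c x) xs ≡ true × Clique c xs

    CliqueIn : Bool → ℕ → (Fin n → Bool) → Set
    CliqueIn c k S = Σ[ xs ∈ Vec (Fin n) k ] (Clique c xs × allV S xs ≡ true)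

    allV-entries : ∀ {k} {S : Fin n → Bool} (xs : Vec (Fin n) k) →
                   allV S xs ≡ true → ∀ y → entries xs y ≡ true → S y ≡ true
    allV-entries {S = S} (x ∷ xs) all y y∈xs with x ≟ y
    ... | yes refl = ∧-conicalˡ (S x) _ all
    ... | no _ = allV-entries xs (∧-conicalʳ (S x) _ all) y y∈xs

    card-entries : ∀ {k} {c} (xs : Vec (Fin n) k) → Clique c xs → card (entries xs) ≡ k
    card-entries [] _ = sum-replicate-zero n
    card-entries {suc k} (x ∷ xs) (x∉xs , _ , clique) = begin
      card (entries (x ∷ xs))                             ≡⟨ sum-cong-≗ split ⟩
      sum (λ y → ⟦ does (x ≟ y) ⟧ + ⟦ entries xs y ⟧)     ≡⟨ ∑-distrib-+ (λ y → ⟦ does (x ≟ y) ⟧) (⟦_⟧ ∘ entries xs) ⟩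
      card (does ∘ (x ≟_)) + card (entries xs)             ≡⟨ cong₂ _+_ (card-≟ x) (card-entries xs clique) ⟩
      suc k                                               ∎
      where
      open ≡-Reasoning
      split : ∀ y → ⟦ does (x ≟ y) ∨ entries xs y ⟧ ≡ ⟦ does (x ≟ y) ⟧ + ⟦ entries xs y ⟧
      split y with x ≟ y
      ... | yes refl rewrite x∉xs = refl
      ... | no _ = refl

    nbhd : (Fin n → Bool) → Fin n → Bool → Fin n → Bool
    nbhd S v c x = S x ∧ (not (does (x ≟ v)) ∧ colour c v x)

    card-nbhd : ∀ S v → S v ≡ true → card S ≡ suc (card (nbhd S v true) + card (nbhd S v false))
    card-nbhd S v Sv = begin
      card S                                                      ≡⟨ sum-cong-≗ split ⟩
      sum (λ x → ⟦ does (x ≟ v) ⟧ + (⟦ nbhd S v true x ⟧ + ⟦ nbhd S v false x ⟧))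
        ≡⟨ ∑-distrib-+ (⟦_⟧ ∘ does ∘ (_≟ v)) _ ⟩
      card (does ∘ (_≟ v)) + sum (λ x → ⟦ nbhd S v true x ⟧ + ⟦ nbhd S v false x ⟧)
        ≡⟨ cong₂ _+_ (card-≟′ v) (∑-distrib-+ (⟦_⟧ ∘ nbhd S v true) (⟦_⟧ ∘ nbhd S v false)) ⟩
      suc (card (nbhd S v true) + card (nbhd S v false))          ∎
      where
      open ≡-Reasoning
      split : ∀ x → ⟦ S x ⟧ ≡ ⟦ does (x ≟ v) ⟧ + (⟦ nbhd S v true x ⟧ + ⟦ nbhd S v false x ⟧)
      split x with x ≟ v
      ... | yes refl rewrite Sv = refl
      ... | no _ with S x | red v x
      ...   | true | true = refl
      ...   | true | false = refl
      ...   | false | _ = refl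

    allV-nbhd : ∀ {k} S v c (xs : Vec (Fin n) k) → allV (nbhd S v c) xs ≡ true →
                allV S xs ≡ true × entries xs v ≡ false × allV (colour c v) xs ≡ true
    allV-nbhd S v c [] _ = refl , refl , refl
    allV-nbhd S v c (x ∷ xs) all with allV-nbhd S v c xs (∧-conicalʳ (nbhd S v c x) _ all)
    ... | Sxs , v∉xs , cxs with S x | x ≟ v | colour c v x | all
    ...   | true | no _ | true | _ = Sxs , v∉xs , cxs

    extend : ∀ {k} c S v → S v ≡ true → CliqueIn c k (nbhd S v c) → CliqueIn c (suc k) S
    extend c S v Sv (xs , clique , all) with allV-nbhd S v c xs all
    ... | Sxs , v∉xs , cxs = v ∷ xs , (v∉xs , cxs , clique) , trans (cong (_∧ allV S xs) Sv) Sxs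

    restrict : ∀ {k c′} c S v → CliqueIn c′ k (nbhd S v c) → CliqueIn c′ k S
    restrict c S v (xs , clique , all) = xs , clique , proj₁ (allV-nbhd S v c xs all)

    ramsey : ∀ r b S → 2 ^ (r + b) ≤ card S → CliqueIn true r S ⊎ CliqueIn false b S
    ramsey zero b S _ = inj₁ ([] , tt , refl)
    ramsey (suc r) zero S _ = inj₂ ([] , tt , refl)
    ramsey (suc r) (suc b) S large with card>0⇒∃ S (<-≤-trans (m^n>0 2 (suc r + suc b)) large)
    ... | v , Sv with 2 ^ (r + suc b) ≤? card (nbhd S v true)
    ...   | yes redLarge =
            Sum.map (extend true S v Sv) (restrict true S v) (ramsey r (suc b) (nbhd S v true) redLarge)
    ...   | no redSmall =
            Sum.map (restrict false S v) (extend false S v Sv) (ramsey (suc r) b (nbhd S v false) blueLarge)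
      where
      blueLarge : 2 ^ (suc r + b) ≤ card (nbhd S v false)
      blueLarge = subst (λ e → 2 ^ e ≤ card (nbhd S v false)) (+-suc r b)
        (pigeonhole (subst (2 ^ suc (r + suc b) ≤_) (card-nbhd S v Sv) large) (≰⇒> redSmall))

    module _ (red-sym : Symmetric red) where

      colour-sym : ∀ c x y → colour c x y ≡ colour c y x
      colour-sym true = red-sym
      colour-sym false x y = cong not (red-sym x y)

      clique-edge : ∀ {k} c (xs : Vec (Fin n) k) → Clique c xs → ∀ x y →
                    entries xs x ≡ true → entries xs y ≡ true → x ≢ y → colour c x y ≡ true
      clique-edge c (z ∷ zs) (_ , z-zs , clique) x y x∈ y∈ x≢y with z ≟ x | z ≟ y
      ... | yes refl | yes refl = ⊥-elim (x≢y refl)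
      ... | yes refl | no _ = allV-entries zs z-zs y y∈
      ... | no _ | yes refl = trans (colour-sym c x z) (allV-entries zs z-zs x x∈)
      ... | no _ | no _ = clique-edge c zs clique x y x∈ y∈ x≢y

  module DependentRandomChoice {n : ℕ} (red : Colouring n) (X Y : Fin n → Bool) (s t m : ℕ) where

    link : Fin n → Fin n → Bool
    link x w = X x ∧ red x w

    degree : Fin n → ℕ
    degree = redDegree red X

    commonNbhd : Vec (Fin n) s → Fin n → Bool
    commonNbhd T w = Y w ∧ allV (λ x → link x w) T

    backNbhd : ∀ {k} → Vec (Fin n) k → Fin n → Bool
    backNbhd ws x = allV (link x) ws

    bad : Vec (Fin n) s → Vec (Fin n) (suc t) → Bool
    bad T ws = does (card (backNbhd ws) ≤? m) ∧ allV (commonNbhd T) ws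

    badFrom : Vec (Fin n) s → Fin n → ℕ
    badFrom T w = ∑V t (λ ws → ⟦ bad T (w ∷ ws) ⟧)

    goodNbhd : Vec (Fin n) s → Fin n → Bool
    goodNbhd T w = commonNbhd T w ∧ (badFrom T w ≡ᵇ 0)

    goodNbhd⊆commonNbhd : ∀ T w → goodNbhd T w ≡ true → commonNbhd T w ≡ true
    goodNbhd⊆commonNbhd T w = ∧-conicalˡ (commonNbhd T w) _

    goodNbhd⇒badFrom≡0 : ∀ T w → goodNbhd T w ≡ true → badFrom T w ≡ 0
    goodNbhd⇒badFrom≡0 T w good with badFrom T w | ∧-conicalʳ (commonNbhd T w) _ good
    ... | zero | _ = refl

    commonNbhd⇒allV-X : ∀ T w → commonNbhd T w ≡ true → allV X T ≡ true
    commonNbhd⇒allV-X T w common =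
      allV-mono (λ x → ∧-conicalˡ (X x) (red x w)) T (∧-conicalʳ (Y w) _ common)

    ∑-card-commonNbhd : ∑V s (card ∘ commonNbhd) ≡ sum (λ w → ⟦ Y w ⟧ * degree w ^ s)
    ∑-card-commonNbhd = begin
      ∑V s (card ∘ commonNbhd)                                  ≡⟨ ∑V-comm-∑ s (λ T → ⟦_⟧ ∘ commonNbhd T) ⟩
      sum (λ w → ∑V s (λ T → ⟦ Y w ∧ allV (λ x → link x w) T ⟧))  ≡⟨ sum-cong-≗ count-w ⟩
      sum (λ w → ⟦ Y w ⟧ * degree w ^ s)                          ∎
      where
      open ≡-Reasoning
      count-w : ∀ w → ∑V s (λ T → ⟦ Y w ∧ allV (λ x → link x w) T ⟧) ≡ ⟦ Y w ⟧ * degree w ^ s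
      count-w w = begin
        ∑V s (λ T → ⟦ Y w ∧ allV (λ x → link x w) T ⟧)        ≡⟨ ∑V-cong s (λ T → ⟦∧⟧ (Y w) _) ⟩
        ∑V s (λ T → ⟦ Y w ⟧ * ⟦ allV (λ x → link x w) T ⟧)    ≡⟨ ∑V-*ˡ s ⟦ Y w ⟧ _ ⟩
        ⟦ Y w ⟧ * ∑V s (⟦_⟧ ∘ allV (λ x → link x w))          ≡⟨ cong (⟦ Y w ⟧ *_) (∑V-allV s (λ x → link x w)) ⟩
        ⟦ Y w ⟧ * degree w ^ s                                ∎

    ∑-card-commonNbhd-≥ : ∀ D → (∀ w → Y w ≡ true → D ≤ degree w) → card Y * D ^ s ≤ ∑V s (card ∘ commonNbhd)
    ∑-card-commonNbhd-≥ D minDegree = begin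
      card Y * D ^ s                       ≡⟨ *-distribʳ-sum (D ^ s) (⟦_⟧ ∘ Y) ⟩
      sum (λ w → ⟦ Y w ⟧ * D ^ s)          ≤⟨ ∑-mono-≤ pointwise ⟩
      sum (λ w → ⟦ Y w ⟧ * degree w ^ s)   ≡⟨ ∑-card-commonNbhd ⟨
      ∑V s (card ∘ commonNbhd)             ∎
      where
      open ≤-Reasoning
      pointwise : ∀ w → ⟦ Y w ⟧ * D ^ s ≤ ⟦ Y w ⟧ * degree w ^ s
      pointwise w with Y w in Yw
      ... | true = *-monoʳ-≤ 1 (^-monoˡ-≤ s (minDegree w Yw))
      ... | false = z≤n

    card-commonNbhd-≤ : ∀ T → card (commonNbhd T) ≤ card (goodNbhd T) + ∑V (suc t) (⟦_⟧ ∘ bad T)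
    card-commonNbhd-≤ T = ≤-trans (∑-mono-≤ pointwise) (≤-reflexive (∑-distrib-+ (⟦_⟧ ∘ goodNbhd T) (badFrom T)))
      where
      pointwise : ∀ w → ⟦ commonNbhd T w ⟧ ≤ ⟦ goodNbhd T w ⟧ + badFrom T w
      pointwise w with commonNbhd T w | badFrom T w
      ... | false | _ = z≤n
      ... | true | zero = ≤-refl
      ... | true | suc _ = s≤s z≤n

    ∑-bad-at : ∀ ws → ∑V s (λ T → ⟦ bad T ws ⟧) ≤ ⟦ allV Y ws ⟧ * m ^ s
    ∑-bad-at ws = ≤-trans (≤-reflexive (∑V-cong s (λ T → cong (λ b → ⟦ isSmall ∧ b ⟧) (allV-comm Y link ws T))))
                          (by-size (card (backNbhd ws) ≤? m))
      where
      isSmall : Bool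
      isSmall = does (card (backNbhd ws) ≤? m)
      by-size : (d : Dec (card (backNbhd ws) ≤ m)) →
                ∑V s (λ T → ⟦ does d ∧ (allV Y ws ∧ allV (backNbhd ws) T) ⟧) ≤ ⟦ allV Y ws ⟧ * m ^ s
      by-size (no _) = ≤-trans (≤-reflexive (∑V-zero s)) z≤n
      by-size (yes small) = begin
        ∑V s (λ T → ⟦ allV Y ws ∧ allV (backNbhd ws) T ⟧)         ≡⟨ ∑V-cong s (λ T → ⟦∧⟧ (allV Y ws) _) ⟩
        ∑V s (λ T → ⟦ allV Y ws ⟧ * ⟦ allV (backNbhd ws) T ⟧)     ≡⟨ ∑V-*ˡ s ⟦ allV Y ws ⟧ _ ⟩
        ⟦ allV Y ws ⟧ * ∑V s (⟦_⟧ ∘ allV (backNbhd ws))           ≡⟨ cong (⟦ allV Y ws ⟧ *_) (∑V-allV s (backNbhd ws)) ⟩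
        ⟦ allV Y ws ⟧ * card (backNbhd ws) ^ s                    ≤⟨ *-monoʳ-≤ ⟦ allV Y ws ⟧ (^-monoˡ-≤ s small) ⟩
        ⟦ allV Y ws ⟧ * m ^ s                                     ∎
        where open ≤-Reasoning

    ∑-bad : ∑V s (λ T → ∑V (suc t) (⟦_⟧ ∘ bad T)) ≤ card Y ^ suc t * m ^ s
    ∑-bad = begin
      ∑V s (λ T → ∑V (suc t) (⟦_⟧ ∘ bad T))          ≡⟨ ∑V-comm s (suc t) (λ T → ⟦_⟧ ∘ bad T) ⟩
      ∑V (suc t) (λ ws → ∑V s (λ T → ⟦ bad T ws ⟧))  ≤⟨ ∑V-mono-≤ (suc t) ∑-bad-at ⟩
      ∑V (suc t) (λ ws → ⟦ allV Y ws ⟧ * m ^ s)      ≡⟨ ∑V-cong (suc t) (λ ws → *-comm ⟦ allV Y ws ⟧ (m ^ s)) ⟩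
      ∑V (suc t) (λ ws → m ^ s * ⟦ allV Y ws ⟧)      ≡⟨ ∑V-*ˡ (suc t) (m ^ s) (⟦_⟧ ∘ allV Y) ⟩
      m ^ s * ∑V (suc t) (⟦_⟧ ∘ allV Y)              ≡⟨ cong (m ^ s *_) (∑V-allV (suc t) Y) ⟩
      m ^ s * card Y ^ suc t                         ≡⟨ *-comm (m ^ s) _ ⟩
      card Y ^ suc t * m ^ s                         ∎
      where open ≤-Reasoning

    ∑-card-goodNbhd-large : ∀ D → (∀ w → Y w ≡ true → D ≤ degree w) →
                        card Y ^ suc t * m ^ s + m * card X ^ s < card Y * D ^ s →
                        ∑V s (λ T → m * ⟦ allV X T ⟧) < ∑V s (card ∘ goodNbhd)
    ∑-card-goodNbhd-large D minDegree large = begin-strict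
      ∑V s (λ T → m * ⟦ allV X T ⟧)    ≡⟨ ∑V-*ˡ s m (⟦_⟧ ∘ allV X) ⟩
      m * ∑V s (⟦_⟧ ∘ allV X)          ≡⟨ cong (m *_) (∑V-allV s X) ⟩
      m * card X ^ s
        <⟨ +-cancelˡ-< badTotal _ _ (<-≤-trans large (≤-trans chain (≤-reflexive (+-comm good badTotal)))) ⟩
      good                             ∎
      where
      open ≤-Reasoning
      good badTotal : ℕ
      good = ∑V s (card ∘ goodNbhd)
      badTotal = card Y ^ suc t * m ^ s
      chain : card Y * D ^ s ≤ good + badTotal
      chain = begin
        card Y * D ^ s                                       ≤⟨ ∑-card-commonNbhd-≥ D minDegree ⟩
        ∑V s (card ∘ commonNbhd)                             ≤⟨ ∑V-mono-≤ s card-commonNbhd-≤ ⟩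
        ∑V s (λ T → card (goodNbhd T) + ∑V (suc t) (⟦_⟧ ∘ bad T))
                                                             ≡⟨ ∑V-distrib-+ s (card ∘ goodNbhd) _ ⟩
        good + ∑V s (λ T → ∑V (suc t) (⟦_⟧ ∘ bad T))         ≤⟨ +-monoʳ-≤ good ∑-bad ⟩
        good + badTotal                                      ∎

    dependentRandomChoice : ∀ D → (∀ w → Y w ≡ true → D ≤ degree w) →
                            card Y ^ suc t * m ^ s + m * card X ^ s < card Y * D ^ s →
                            ∃[ T ] m < card (goodNbhd T)
    dependentRandomChoice D minDegree large
      with ∑V<∑V⇒∃< s (λ T → m * ⟦ allV X T ⟧) (card ∘ goodNbhd) (∑-card-goodNbhd-large D minDegree large)
    ... | T , m*[T⊆X]<good with allV X T in T⊆X
    ...   | true = T , subst (_< card (goodNbhd T)) (*-identityʳ m) m*[T⊆X]<good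
    ...   | false with card>0⇒∃ (goodNbhd T) (subst (_< card (goodNbhd T)) (*-zeroʳ m) m*[T⊆X]<good)
    ...     | w , good-w with () ← trans (sym T⊆X) (commonNbhd⇒allV-X T w (goodNbhd⊆commonNbhd T w good-w))

    goodNbhd-tuple : ∀ T (ws : Vec (Fin n) (suc t)) → allV (goodNbhd T) ws ≡ true → m < card (backNbhd ws)
    goodNbhd-tuple T (w ∷ ws) good with card (backNbhd (w ∷ ws)) ≤? m
    ... | no large = ≰⇒> large
    ... | yes small = ⊥-elim (1+n≰n (begin
      1                          ≡⟨ cong ⟦_⟧ isBad ⟨
      ⟦ bad T (w ∷ ws) ⟧         ≤⟨ term≤∑V t (λ vs → ⟦ bad T (w ∷ vs) ⟧) ws ⟩
      badFrom T w                ≡⟨ goodNbhd⇒badFrom≡0 T w (∧-conicalˡ (goodNbhd T w) _ good) ⟩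
      0                          ∎))
      where
      open ≤-Reasoning
      isBad : bad T (w ∷ ws) ≡ true
      isBad = cong₂ _∧_ (dec-true (card (backNbhd (w ∷ ws)) ≤? m) small)
                        (allV-mono (goodNbhd⊆commonNbhd T) (w ∷ ws) good)

module Arithmetic where

  open import Data.List using (_∷_; [])
  open import Data.Nat using (ℕ; zero; suc; _+_; _*_; _^_; _≤_; _<_; z≤n; s≤s; NonZero; >-nonZero; _/_)
  open import Data.Nat.DivMod using (m/n*n≤m; m≡m%n+[m/n]*n; m%n<n)
  open import Data.Nat.Properties
  open import Data.Nat.Tactic.RingSolver using (solve-∀; solve)
  open import Data.Product using (_×_; _,_)
  open import Relation.Binary.PropositionalEquality

  floor-division : ∀ a b .{{_ : NonZero b}} → a / b * b ≤ a × a < suc (a / b) * b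
  floor-division a b = m/n*n≤m a b ,
    subst (_< suc (a / b) * b) (sym (m≡m%n+[m/n]*n a b)) (+-monoˡ-< (a / b * b) (m%n<n a b))

  ^-distribʳ-* : ∀ a b k → (a * b) ^ k ≡ a ^ k * b ^ k
  ^-distribʳ-* a b zero = refl
  ^-distribʳ-* a b (suc k) = trans (cong (a * b *_) (^-distribʳ-* a b k)) (ab*cd≡ac*bd a b (a ^ k) (b ^ k))
    where
    ab*cd≡ac*bd : ∀ a b c d → a * b * (c * d) ≡ a * c * (b * d)
    ab*cd≡ac*bd = solve-∀

  ^-ratio-split : ∀ {p q} c x j k → 0 < p → c * p ≤ q → q ^ (j + k) ≤ x * p ^ (j + k) → q ^ j * c ^ k ≤ x * p ^ j
  ^-ratio-split {p} {q} c x j k p>0 cp≤q q^[j+k]≤xp^[j+k] =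
    *-cancelʳ-≤ _ _ (p ^ k) {{m^n≢0 p k {{>-nonZero p>0}}}} (begin
      q ^ j * c ^ k * p ^ k    ≡⟨ *-assoc (q ^ j) (c ^ k) (p ^ k) ⟩
      q ^ j * (c ^ k * p ^ k)  ≡⟨ cong (q ^ j *_) (^-distribʳ-* c p k) ⟨
      q ^ j * (c * p) ^ k      ≤⟨ *-monoʳ-≤ (q ^ j) (^-monoˡ-≤ k cp≤q) ⟩
      q ^ j * q ^ k            ≡⟨ ^-distribˡ-+-* q j k ⟨
      q ^ (j + k)              ≤⟨ q^[j+k]≤xp^[j+k] ⟩
      x * p ^ (j + k)          ≡⟨ trans (cong (x *_) (^-distribˡ-+-* p j k)) (sym (*-assoc x _ _)) ⟩
      x * p ^ j * p ^ k        ∎)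
    where open ≤-Reasoning

  -- Opaque so that the conversion checker never unfolds 2 ^ 20 * n into 2²⁰ additions.
  opaque
    L : ℕ
    L = 2 ^ 20

    L≡2^20 : L ≡ 2 ^ 20
    L≡2^20 = refl

  instance
    L≢0 : NonZero L
    L≢0 = subst NonZero (sym L≡2^20) _

  L*a^20≤b^20 : ∀ {a b} → 2 * a ≤ b → L * a ^ 20 ≤ b ^ 20
  L*a^20≤b^20 {a} {b} 2a≤b = subst (λ c → c * a ^ 20 ≤ b ^ 20) (sym L≡2^20) (2^k*a^k≤b^k 20)
    where
    2^k*a^k≤b^k : ∀ k → 2 ^ k * a ^ k ≤ b ^ k
    2^k*a^k≤b^k k = subst (_≤ b ^ k) (^-distribʳ-* 2 a k) (^-monoˡ-≤ k 2a≤b)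

  a^[80t]≡[a^20]^[4t] : ∀ a t → a ^ (80 * t) ≡ (a ^ 20) ^ (4 * t)
  a^[80t]≡[a^20]^[4t] a t = trans (cong (a ^_) (*-assoc 20 4 t)) (sym (^-*-assoc a 20 (4 * t)))

  L^k≡2^[20k] : ∀ k → L ^ k ≡ 2 ^ (20 * k)
  L^k≡2^[20k] k = trans (cong (_^ k) L≡2^20) (^-*-assoc 2 20 k)

  4≤L^[1+k] : ∀ k → 4 ≤ L ^ suc k
  4≤L^[1+k] k = ≤-trans (subst (4 ≤_) (sym L≡2^20) (s≤s (s≤s (s≤s (s≤s z≤n))))) (m≤m*n L (L ^ k) {{m^n≢0 L k}})

  4t≡1+[3+4t′] : ∀ t′ → 4 * suc t′ ≡ 1 + (3 + 4 * t′)
  4t≡1+[3+4t′] = solve-∀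

  4t≡s+s : ∀ t′ → 4 * suc t′ ≡ (suc t′ + suc t′) + (suc t′ + suc t′)
  4t≡s+s = solve-∀

  4t≡[1+s]+[1+2t′] : ∀ t′ → 4 * suc t′ ≡ suc (suc t′ + suc t′) + suc (2 * t′)
  4t≡[1+s]+[1+2t′] = solve-∀

  2+3s+slack≡20[1+2t′] : ∀ t′ → let s = suc t′ + suc t′ in 2 + (s + 2 * s) + (34 * t′ + 12) ≡ 20 * suc (2 * t′)
  2+3s+slack≡20[1+2t′] = solve-∀

  1+s²+2s+slack≡20s+80t² : ∀ t′ → let t = suc t′; s = t + t in
               1 + (s * s + 2 * s) + (76 * t′ * t′ + 188 * t′ + 111) ≡ 20 * s + 20 * (4 * t * t)
  1+s²+2s+slack≡20s+80t² = solve-∀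

  -- Here p/q = δ²⁰, x ≥ y are the sizes of the two sides, y′ is the number of vertices of the smaller
  -- side with at least D = ⌊px/2q⌋ red neighbours and E is the number of red edges; the goal is the
  -- hypothesis of dependent random choice with s = 2t random vertices and threshold m = 2^(2t).
  module DensityBounds (t′ p q x y : ℕ) (p>0 : 0 < p) (Lp≤q : L * p ≤ q)
                       (y-large : q ^ (4 * suc t′) ≤ y * p ^ (4 * suc t′)) (y≤x : y ≤ x) where

    t s m : ℕ
    t = suc t′
    s = t + t
    m = 2 ^ s

    x-large : q ^ (4 * t) ≤ x * p ^ (4 * t)
    x-large = ≤-trans y-large (*-monoˡ-≤ (p ^ (4 * t)) y≤x)

    4q≤px : 4 * q ≤ p * x
    4q≤px = begin
      4 * q                      ≤⟨ *-monoˡ-≤ q (4≤L^[1+k] (2 + 4 * t′)) ⟩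
      L ^ (3 + 4 * t′) * q       ≡⟨ *-comm (L ^ (3 + 4 * t′)) q ⟩
      q * L ^ (3 + 4 * t′)       ≡⟨ cong (_* L ^ (3 + 4 * t′)) (^-identityʳ q) ⟨
      q ^ 1 * L ^ (3 + 4 * t′)   ≤⟨ ^-ratio-split L x 1 (3 + 4 * t′) p>0 Lp≤q
                                      (subst (λ e → q ^ e ≤ x * p ^ e) (4t≡1+[3+4t′] t′) x-large) ⟩
      x * p ^ 1                  ≡⟨ trans (cong (x *_) (^-identityʳ p)) (*-comm x p) ⟩
      p * x                      ∎
      where open ≤-Reasoning

    x-ratio : q ^ s * L ^ s ≤ x * p ^ s
    x-ratio = ^-ratio-split L x s s p>0 Lp≤q (subst (λ e → q ^ e ≤ x * p ^ e) (4t≡s+s t′) x-large)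

    L^4t≤x : L ^ (4 * t) ≤ x
    L^4t≤x = subst₂ _≤_ (*-identityˡ _) (*-identityʳ x) (^-ratio-split L x 0 (4 * t) p>0 Lp≤q x-large)

    y-ratio : q ^ suc s * L ^ suc (2 * t′) ≤ y * p ^ suc s
    y-ratio = ^-ratio-split L y (suc s) (suc (2 * t′)) p>0 Lp≤q
                (subst (λ e → q ^ e ≤ y * p ^ e) (4t≡[1+s]+[1+2t′] t′) y-large)

    2*[m^s*4^s]≤L^s*[L^4t]^t : 2 * (m ^ s * 4 ^ s) ≤ L ^ s * (L ^ (4 * t)) ^ t
    2*[m^s*4^s]≤L^s*[L^4t]^t = begin
      2 * (m ^ s * 4 ^ s)                    ≡⟨ cong₂ (λ a b → 2 * (a * b)) (^-*-assoc 2 s s) (^-*-assoc 2 2 s) ⟩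
      2 * (2 ^ (s * s) * 2 ^ (2 * s))        ≡⟨ cong (2 *_) (^-distribˡ-+-* 2 (s * s) (2 * s)) ⟨
      2 ^ (1 + (s * s + 2 * s))              ≤⟨ ^-monoʳ-≤ 2 (m≤m+n (1 + (s * s + 2 * s)) (76 * t′ * t′ + 188 * t′ + 111)) ⟩
      2 ^ (1 + (s * s + 2 * s) + (76 * t′ * t′ + 188 * t′ + 111))
                                             ≡⟨ cong (2 ^_) (1+s²+2s+slack≡20s+80t² t′) ⟩
      2 ^ (20 * s + 20 * (4 * t * t))        ≡⟨ ^-distribˡ-+-* 2 (20 * s) (20 * (4 * t * t)) ⟩
      2 ^ (20 * s) * 2 ^ (20 * (4 * t * t))
        ≡⟨ cong₂ _*_ (L^k≡2^[20k] s) (trans (^-*-assoc L (4 * t) t) (L^k≡2^[20k] (4 * t * t))) ⟨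
      L ^ s * (L ^ (4 * t)) ^ t              ∎
      where open ≤-Reasoning

    2*[2*[m*4^s]]≤L^[1+2t′] : 2 * (2 * (m * 4 ^ s)) ≤ L ^ suc (2 * t′)
    2*[2*[m*4^s]]≤L^[1+2t′] = begin
      2 * (2 * (m * 4 ^ s))                    ≡⟨ cong (λ e → 2 * (2 * (m * e))) (^-*-assoc 2 2 s) ⟩
      2 * (2 * (2 ^ s * 2 ^ (2 * s)))          ≡⟨ cong (λ e → 2 * (2 * e)) (^-distribˡ-+-* 2 s (2 * s)) ⟨
      2 ^ (2 + (s + 2 * s))                    ≤⟨ ^-monoʳ-≤ 2 (m≤m+n (2 + (s + 2 * s)) (34 * t′ + 12)) ⟩
      2 ^ (2 + (s + 2 * s) + (34 * t′ + 12))   ≡⟨ cong (2 ^_) (2+3s+slack≡20[1+2t′] t′) ⟩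
      2 ^ (20 * suc (2 * t′))                  ≡⟨ L^k≡2^[20k] (suc (2 * t′)) ⟨
      L ^ suc (2 * t′)                         ∎
      where open ≤-Reasoning

    2*x^t′*m^s*[4q]^s≤[px]^s : 2 * x ^ t′ * m ^ s * (4 * q) ^ s ≤ (p * x) ^ s
    2*x^t′*m^s*[4q]^s≤[px]^s = begin
      2 * x ^ t′ * m ^ s * (4 * q) ^ s              ≡⟨ cong (2 * x ^ t′ * m ^ s *_) (^-distribʳ-* 4 q s) ⟩
      2 * x ^ t′ * m ^ s * (4 ^ s * q ^ s)          ≡⟨ 2bm*fq≡b[2[mf]]q (x ^ t′) (m ^ s) (4 ^ s) (q ^ s) ⟩
      x ^ t′ * (2 * (m ^ s * 4 ^ s)) * q ^ s        ≤⟨ *-monoˡ-≤ (q ^ s) (*-monoʳ-≤ (x ^ t′) 2*[m^s*4^s]≤L^s*[L^4t]^t) ⟩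
      x ^ t′ * (L ^ s * (L ^ (4 * t)) ^ t) * q ^ s  ≡⟨ b[lL]q≡b[ql]L (x ^ t′) (L ^ s) ((L ^ (4 * t)) ^ t) (q ^ s) ⟩
      x ^ t′ * (q ^ s * L ^ s) * (L ^ (4 * t)) ^ t  ≤⟨ *-mono-≤ (*-monoʳ-≤ (x ^ t′) x-ratio) (^-monoˡ-≤ t L^4t≤x) ⟩
      x ^ t′ * (x * p ^ s) * x ^ t                  ≡⟨ b[xP]X≡P[b[xX]] (x ^ t′) x (p ^ s) (x ^ t) ⟩
      p ^ s * (x ^ t′ * x ^ suc t)
        ≡⟨ cong (p ^ s *_) (trans (sym (^-distribˡ-+-* x t′ (suc t))) (cong (x ^_) (+-suc t′ t))) ⟩
      p ^ s * x ^ s                                 ≡⟨ ^-distribʳ-* p x s ⟨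
      (p * x) ^ s                                   ∎
      where
      open ≤-Reasoning
      2bm*fq≡b[2[mf]]q : ∀ b m f q → 2 * b * m * (f * q) ≡ b * (2 * (m * f)) * q
      2bm*fq≡b[2[mf]]q = solve-∀
      b[lL]q≡b[ql]L : ∀ b l L q → b * (l * L) * q ≡ b * (q * l) * L
      b[lL]q≡b[ql]L = solve-∀
      b[xP]X≡P[b[xX]] : ∀ b x P X → b * (x * P) * X ≡ P * (b * (x * X))
      b[xP]X≡P[b[xX]] = solve-∀

    module _ (D : ℕ) (D-below : D * (2 * q) ≤ p * x) (D-above : p * x < suc D * (2 * q)) where

      px<D*4q : p * x < D * (4 * q)
      px<D*4q = +-cancelʳ-< (4 * q) (p * x) (D * (4 * q)) (begin-strict
        p * x + 4 * q           ≤⟨ +-monoʳ-≤ (p * x) 4q≤px ⟩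
        p * x + p * x           ≡⟨ solve (p ∷ x ∷ []) ⟩
        2 * (p * x)             <⟨ *-monoʳ-< 2 D-above ⟩
        2 * (suc D * (2 * q))   ≡⟨ solve (D ∷ q ∷ []) ⟩
        D * (4 * q) + 4 * q     ∎)
        where open ≤-Reasoning

      2*x^t′*m^s≤D^s : 2 * x ^ t′ * m ^ s ≤ D ^ s
      2*x^t′*m^s≤D^s = *-cancelʳ-≤ _ _ ((4 * q) ^ s) {{m^n≢0 (4 * q) s {{>-nonZero 4q>0}}}} (begin
        2 * x ^ t′ * m ^ s * (4 * q) ^ s   ≤⟨ 2*x^t′*m^s*[4q]^s≤[px]^s ⟩
        (p * x) ^ s                        ≤⟨ ^-monoˡ-≤ s (<⇒≤ px<D*4q) ⟩
        (D * (4 * q)) ^ s                  ≡⟨ ^-distribʳ-* D (4 * q) s ⟩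
        D ^ s * (4 * q) ^ s                ∎)
        where
        open ≤-Reasoning
        4q>0 : 0 < 4 * q
        4q>0 = <-≤-trans p>0 (≤-trans (m≤n*m p L) (≤-trans Lp≤q (m≤n*m q 4)))

      bad-term : ∀ y′ → y′ ≤ x → 2 * (y′ ^ t * m ^ s) ≤ y′ * D ^ s
      bad-term y′ y′≤x = begin
        2 * (y′ * y′ ^ t′ * m ^ s)   ≡⟨ 2[abc]≡a[2bc] y′ (y′ ^ t′) (m ^ s) ⟩
        y′ * (2 * y′ ^ t′ * m ^ s)   ≤⟨ *-monoʳ-≤ y′ (*-monoˡ-≤ (m ^ s) (*-monoʳ-≤ 2 (^-monoˡ-≤ t′ y′≤x))) ⟩
        y′ * (2 * x ^ t′ * m ^ s)    ≤⟨ *-monoʳ-≤ y′ 2*x^t′*m^s≤D^s ⟩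
        y′ * D ^ s                   ∎
        where
        open ≤-Reasoning
        2[abc]≡a[2bc] : ∀ a b c → 2 * (a * b * c) ≡ a * (2 * b * c)
        2[abc]≡a[2bc] = solve-∀

      module _ (y′ E : ℕ) (y′≤y : y′ ≤ y) (E≤ : E ≤ y′ * x + y * D) (dense : p * x * y < E * q) where

        py<2qy′ : p * y < 2 * q * y′
        py<2qy′ = *-cancelʳ-< x (p * y) (2 * q * y′) (+-cancelʳ-< (p * x * y) _ _ (begin-strict
          p * y * x + p * x * y                 ≡⟨ solve (p ∷ x ∷ y ∷ []) ⟩
          2 * (p * x * y)                       <⟨ *-monoʳ-< 2 dense ⟩
          2 * (E * q)                           ≤⟨ *-monoʳ-≤ 2 (*-monoˡ-≤ q E≤) ⟩
          2 * ((y′ * x + y * D) * q)            ≡⟨ solve (y′ ∷ x ∷ y ∷ D ∷ q ∷ []) ⟩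
          2 * q * y′ * x + y * (D * (2 * q))    ≤⟨ +-monoʳ-≤ (2 * q * y′ * x) (*-monoʳ-≤ y D-below) ⟩
          2 * q * y′ * x + y * (p * x)          ≡⟨ solve (q ∷ y′ ∷ x ∷ y ∷ p ∷ []) ⟩
          2 * q * y′ * x + p * x * y            ∎))
          where open ≤-Reasoning

        threshold-term : 2 * m * x ^ s < y′ * D ^ s
        threshold-term = *-cancelʳ-< K (2 * m * x ^ s) (y′ * D ^ s) (begin-strict
          2 * m * x ^ s * K                  ≡⟨ abc≡acb (2 * m) (x ^ s) K ⟩
          2 * m * K * x ^ s                  ≤⟨ *-monoˡ-≤ (x ^ s) 2mK≤yp^[1+s] ⟩
          y * p ^ suc s * x ^ s              ≡⟨ y[pP]X≡py[PX] y p (p ^ s) (x ^ s) ⟩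
          p * y * (p ^ s * x ^ s)            ≡⟨ cong (p * y *_) (^-distribʳ-* p x s) ⟨
          p * y * (p * x) ^ s                <⟨ *-mono-< py<2qy′ (^-monoˡ-< s px<D*4q) ⟩
          2 * q * y′ * (D * (4 * q)) ^ s     ≡⟨ cong (2 * q * y′ *_) (^-distribʳ-* D (4 * q) s) ⟩
          2 * q * y′ * (D ^ s * (4 * q) ^ s) ≡⟨ ay[df]≡yd[af] (2 * q) y′ (D ^ s) ((4 * q) ^ s) ⟩
          y′ * D ^ s * K                     ∎)
          where
          open ≤-Reasoning
          K : ℕ
          K = 2 * q * (4 * q) ^ s
          abc≡acb : ∀ a b c → a * b * c ≡ a * c * b
          abc≡acb = solve-∀
          y[pP]X≡py[PX] : ∀ y p P X → y * (p * P) * X ≡ p * y * (P * X)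
          y[pP]X≡py[PX] = solve-∀
          ay[df]≡yd[af] : ∀ a y d f → a * y * (d * f) ≡ y * d * (a * f)
          ay[df]≡yd[af] = solve-∀
          2m[2q[fQ]]≡2[2[mf]][qQ] : ∀ m q f Q → 2 * m * (2 * q * (f * Q)) ≡ 2 * (2 * (m * f)) * (q * Q)
          2m[2q[fQ]]≡2[2[mf]][qQ] = solve-∀
          2mK≤yp^[1+s] : 2 * m * K ≤ y * p ^ suc s
          2mK≤yp^[1+s] = begin
            2 * m * K                             ≡⟨ cong (λ e → 2 * m * (2 * q * e)) (^-distribʳ-* 4 q s) ⟩
            2 * m * (2 * q * (4 ^ s * q ^ s))     ≡⟨ 2m[2q[fQ]]≡2[2[mf]][qQ] m q (4 ^ s) (q ^ s) ⟩
            2 * (2 * (m * 4 ^ s)) * q ^ suc s     ≤⟨ *-monoˡ-≤ (q ^ suc s) 2*[2*[m*4^s]]≤L^[1+2t′] ⟩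
            L ^ suc (2 * t′) * q ^ suc s          ≡⟨ *-comm (L ^ suc (2 * t′)) (q ^ suc s) ⟩
            q ^ suc s * L ^ suc (2 * t′)          ≤⟨ y-ratio ⟩
            y * p ^ suc s                         ∎

        drc-condition : y′ ^ t * m ^ s + m * x ^ s < y′ * D ^ s
        drc-condition = *-cancelˡ-< 2 _ _ (begin-strict
          2 * (y′ ^ t * m ^ s + m * x ^ s)       ≡⟨ *-distribˡ-+ 2 (y′ ^ t * m ^ s) (m * x ^ s) ⟩
          2 * (y′ ^ t * m ^ s) + 2 * (m * x ^ s) ≡⟨ cong (2 * (y′ ^ t * m ^ s) +_) (*-assoc 2 m (x ^ s)) ⟨
          2 * (y′ ^ t * m ^ s) + 2 * m * x ^ s   <⟨ +-mono-≤-< (bad-term y′ (≤-trans y′≤y y≤x)) threshold-term ⟩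
          y′ * D ^ s + y′ * D ^ s                ≡⟨ cong (y′ * D ^ s +_) (+-identityʳ (y′ * D ^ s)) ⟨
          2 * (y′ * D ^ s)                       ∎)
          where open ≤-Reasoning

module InducedBipartite where

  open import Data.Bool using (Bool; true; false; _∧_)
  open import Data.Bool.Properties using (∧-conicalˡ; ∧-conicalʳ; ¬-not; not-injective)
  open import Data.Empty using (⊥; ⊥-elim)
  open import Data.Fin using (Fin; zero; suc)
  open import Data.Fin.Subset using (Subset; _∈_; _⊆_; ∣_∣; inside; outside)
  open import Data.Fin.Subset.Properties using (_∈?_)
  open import Data.List using (map; allFin)
  import Data.List as List
  open import Data.List.Properties using (map-tabulate)
  import Data.Nat.ListAction as ListAction
  open import Data.Nat using (ℕ; zero; suc; _+_; _*_; _^_; _≤_; _<_; z≤n; _≤?_; NonZero; >-nonZero; _/_)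
  open import Data.Nat.Properties
  open import Data.Product using (∃-syntax; _×_; _,_; proj₁; proj₂)
  open import Data.Sum using (inj₁; inj₂)
  open import Data.Vec using (Vec; []; _∷_; lookup; tabulate)
  open import Data.Vec.Properties using (lookup∘tabulate; []=⇒lookup; lookup⇒[]=)
  open import Function using (_∘_; id)
  open import Relation.Binary.PropositionalEquality
  open import Relation.Nullary using (¬_; Dec; yes; no; does)
  open import Relation.Nullary.Decidable using (⌊_⌋)
  open import Algebra.Properties.Semiring.Sum +-*-semiring
    using (sum; sum-cong-≗; ∑-distrib-+; ∑-comm; *-distribˡ-sum; *-distribʳ-sum)
  open Combinatorics
  open Arithmetic using (L; L≢0; floor-division; module DensityBounds)

  toSubset : ∀ {n} → (Fin n → Bool) → Subset n
  toSubset = tabulate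

  ∈-toSubset⁻ : ∀ {n} {S : Fin n → Bool} {x} → x ∈ toSubset S → S x ≡ true
  ∈-toSubset⁻ {S = S} {x} x∈S = trans (sym (lookup∘tabulate S x)) ([]=⇒lookup x∈S)

  ∣∣≡card : ∀ {n} (A : Subset n) → ∣ A ∣ ≡ card (lookup A)
  ∣∣≡card [] = refl
  ∣∣≡card (inside ∷ A) = cong suc (∣∣≡card A)
  ∣∣≡card (outside ∷ A) = ∣∣≡card A

  ∣toSubset∣ : ∀ {n} (S : Fin n → Bool) → ∣ toSubset S ∣ ≡ card S
  ∣toSubset∣ S = trans (∣∣≡card (toSubset S)) (sum-cong-≗ (cong ⟦_⟧ ∘ lookup∘tabulate S))

  ⌊∈?⌋≡lookup : ∀ {n} (x : Fin n) (A : Subset n) → ⌊ x ∈? A ⌋ ≡ lookup A x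
  ⌊∈?⌋≡lookup x A with x ∈? A
  ... | yes x∈A = sym ([]=⇒lookup x∈A)
  ... | no x∉A = sym (¬-not (x∉A ∘ lookup⇒[]= x A))

  listSum≡sum : ∀ {n} (f : Fin n → ℕ) → ListAction.sum (map f (allFin n)) ≡ sum f
  listSum≡sum f = trans (cong ListAction.sum (map-tabulate id f)) (sum-tabulate f)
    where
    sum-tabulate : ∀ {n} (f : Fin n → ℕ) → ListAction.sum (List.tabulate f) ≡ sum f
    sum-tabulate {zero} f = refl
    sum-tabulate {suc n} f = cong (f zero +_) (sum-tabulate (f ∘ suc))

  module _ {n : ℕ} (red : Colouring n) where

    redPair : Subset n → Subset n → Fin n → Fin n → Bool
    redPair A B a b = lookup A a ∧ (lookup B b ∧ red a b)

    eR≡∑∑ : ∀ A B → eR red A B ≡ sum (λ a → sum (λ b → ⟦ redPair A B a b ⟧))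
    eR≡∑∑ A B = trans (listSum≡sum (λ a → ListAction.sum (map (indicator a) (allFin n))))
                      (sum-cong-≗ (λ a → trans (listSum≡sum (indicator a)) (sum-cong-≗ (λ b →
                        cong₂ (λ u v → ⟦ u ∧ (v ∧ red a b) ⟧) (⌊∈?⌋≡lookup a A) (⌊∈?⌋≡lookup b B)))))
      where
      indicator : Fin n → Fin n → ℕ
      indicator a b = ⟦ ⌊ a ∈? A ⌋ ∧ ⌊ b ∈? B ⌋ ∧ red a b ⟧

    eR≡∑redDegree : ∀ A B → eR red A B ≡ sum (λ w → ⟦ lookup B w ⟧ * redDegree red (lookup A) w)
    eR≡∑redDegree A B = begin
      eR red A B                                            ≡⟨ eR≡∑∑ A B ⟩
      sum (λ a → sum (λ b → ⟦ redPair A B a b ⟧))           ≡⟨ ∑-comm (λ a b → ⟦ redPair A B a b ⟧) ⟩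
      sum (λ b → sum (λ a → ⟦ redPair A B a b ⟧))           ≡⟨ sum-cong-≗ (λ b → sum-cong-≗ (λ a → pull-out a b)) ⟩
      sum (λ b → sum (λ a → ⟦ lookup B b ⟧ * ⟦ lookup A a ∧ red a b ⟧))
        ≡⟨ sum-cong-≗ (λ b → *-distribˡ-sum ⟦ lookup B b ⟧ (λ a → ⟦ lookup A a ∧ red a b ⟧)) ⟨
      sum (λ b → ⟦ lookup B b ⟧ * redDegree red (lookup A) b) ∎
      where
      open ≡-Reasoning
      pull-out : ∀ a b → ⟦ redPair A B a b ⟧ ≡ ⟦ lookup B b ⟧ * ⟦ lookup A a ∧ red a b ⟧
      pull-out a b with lookup A a | lookup B b
      ... | x | true = sym (+-identityʳ _)
      ... | true | false = refl
      ... | false | false = refl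

    eR-comm : Symmetric red → ∀ A B → eR red A B ≡ eR red B A
    eR-comm red-sym A B = begin
      eR red A B                                    ≡⟨ eR≡∑∑ A B ⟩
      sum (λ a → sum (λ b → ⟦ redPair A B a b ⟧))   ≡⟨ ∑-comm (λ a b → ⟦ redPair A B a b ⟧) ⟩
      sum (λ b → sum (λ a → ⟦ redPair A B a b ⟧))   ≡⟨ sum-cong-≗ (λ b → sum-cong-≗ (λ a → cong ⟦_⟧ (swap a b))) ⟩
      sum (λ b → sum (λ a → ⟦ redPair B A b a ⟧))   ≡⟨ eR≡∑∑ B A ⟨
      eR red B A                                    ∎
      where
      open ≡-Reasoning
      swap : ∀ a b → redPair A B a b ≡ redPair B A b a
      swap a b rewrite red-sym a b with lookup A a | lookup B b
      ... | true | _ = refl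
      ... | false | true = refl
      ... | false | false = refl

  module _ {n : ℕ} (red : Colouring n) (red-sym : Symmetric red) where
    open Ramsey red

    cliqueSubset-size : ∀ {k c} (xs : Vec (Fin n) k) → Clique c xs → ∣ toSubset (entries xs) ∣ ≡ k
    cliqueSubset-size xs clique = trans (∣toSubset∣ (entries xs)) (card-entries xs clique)

    blueCliqueSubset : ∀ {k} (xs : Vec (Fin n) k) → Clique false xs → BlueClique red (toSubset (entries xs))
    blueCliqueSubset xs clique x y x∈ y∈ x≢y =
      not-injective (clique-edge red-sym false xs clique x y (∈-toSubset⁻ x∈) (∈-toSubset⁻ y∈) x≢y)

    noRedClique : ∀ {t} (A : Subset n) → ¬ HasRedClique red A t → ¬ CliqueIn true t (lookup A)
    noRedClique A noRed (xs , clique , xs⊆A) =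
      noRed (toSubset (entries xs) , ⊆A , cliqueSubset-size xs clique , redClique)
      where
      ⊆A : toSubset (entries xs) ⊆ A
      ⊆A {x} x∈ = lookup⇒[]= x A (allV-entries xs xs⊆A x (∈-toSubset⁻ x∈))
      redClique : RedClique red (toSubset (entries xs))
      redClique x y x∈ y∈ = clique-edge red-sym true xs clique x y (∈-toSubset⁻ x∈) (∈-toSubset⁻ y∈)

    module _ (t′ : ℕ) (X Y : Fin n → Bool) (X∩Y≡∅ : ∀ x → X x ≡ true → Y x ≡ true → ⊥)
             (noRedX : ¬ CliqueIn true (suc t′) X) (noRedY : ¬ CliqueIn true (suc t′) Y) where

      t m : ℕ
      t = suc t′
      m = 2 ^ (t + t)

      blueClique : ∀ {Z} S → (∀ x → S x ≡ true → Z x ≡ true) → ¬ CliqueIn true t Z → m ≤ card S → CliqueIn false t S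
      blueClique S S⊆Z noRedZ large with ramsey t t S large
      ... | inj₁ (xs , clique , xs⊆S) = ⊥-elim (noRedZ (xs , clique , allV-mono S⊆Z xs xs⊆S))
      ... | inj₂ blue = blue

      module _ (Y′ : Fin n → Bool) (Y′⊆Y : ∀ w → Y′ w ≡ true → Y w ≡ true) where
        open DependentRandomChoice red X Y′ (t + t) t′ m

        goodNbhd⊆Y : ∀ T w → goodNbhd T w ≡ true → Y w ≡ true
        goodNbhd⊆Y T w good = Y′⊆Y w (∧-conicalˡ (Y′ w) _ (goodNbhd⊆commonNbhd T w good))

        backNbhd⊆X : ∀ (ws : Vec (Fin n) t) x → backNbhd ws x ≡ true → X x ≡ true
        backNbhd⊆X (w ∷ ws) x back = ∧-conicalˡ (X x) _ (∧-conicalˡ (link x w) _ back)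

        inducedKtt : ∀ T → m < card (goodNbhd T) → HasInducedRedKtt red t
        inducedKtt T large with blueClique (goodNbhd T) (goodNbhd⊆Y T) noRedY (<⇒≤ large)
        ... | Q , blueQ , Q⊆good with blueClique (backNbhd Q) (backNbhd⊆X Q) noRedX (<⇒≤ (goodNbhd-tuple T Q Q⊆good))
        ...   | P , blueP , P⊆back =
                toSubset (entries P) , toSubset (entries Q) , disjoint ,
                cliqueSubset-size P blueP , cliqueSubset-size Q blueQ , allRed ,
                blueCliqueSubset P blueP , blueCliqueSubset Q blueQ
          where
          inP : ∀ x → x ∈ toSubset (entries P) → backNbhd Q x ≡ true
          inP x x∈ = allV-entries P P⊆back x (∈-toSubset⁻ x∈)
          inQ : ∀ w → w ∈ toSubset (entries Q) → goodNbhd T w ≡ true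
          inQ w w∈ = allV-entries Q Q⊆good w (∈-toSubset⁻ w∈)
          disjoint : DisjointSets (toSubset (entries P)) (toSubset (entries Q))
          disjoint x x∈P x∈Q = X∩Y≡∅ x (backNbhd⊆X Q x (inP x x∈P)) (goodNbhd⊆Y T x (inQ x x∈Q))
          allRed : AllRedBetween red (toSubset (entries P)) (toSubset (entries Q))
          allRed x w x∈ w∈ = ∧-conicalʳ (X x) _ (allV-entries Q (inP x x∈) w (∈-toSubset⁻ w∈))

      highDegree : ℕ → Fin n → Bool
      highDegree D w = Y w ∧ does (D ≤? redDegree red X w)

      highDegree⊆Y : ∀ D w → highDegree D w ≡ true → Y w ≡ true
      highDegree⊆Y D w = ∧-conicalˡ (Y w) _

      highDegree-min : ∀ D w → highDegree D w ≡ true → D ≤ redDegree red X w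
      highDegree-min D w = by-cases (D ≤? redDegree red X w)
        where
        by-cases : (d : Dec (D ≤ redDegree red X w)) → Y w ∧ does d ≡ true → D ≤ redDegree red X w
        by-cases (yes D≤degree) _ = D≤degree
        by-cases (no _) high with () ← ∧-conicalʳ (Y w) false high

      redDegree≤card : ∀ w → redDegree red X w ≤ card X
      redDegree≤card w = card-mono (λ x → ∧-conicalˡ (X x) (red x w))

      ∑redDegree-≤ : ∀ D → sum (λ w → ⟦ Y w ⟧ * redDegree red X w) ≤ card (highDegree D) * card X + card Y * D
      ∑redDegree-≤ D = begin
        sum (λ w → ⟦ Y w ⟧ * redDegree red X w)
          ≤⟨ ∑-mono-≤ pointwise ⟩
        sum (λ w → ⟦ highDegree D w ⟧ * card X + ⟦ Y w ⟧ * D)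
          ≡⟨ ∑-distrib-+ (λ w → ⟦ highDegree D w ⟧ * card X) (λ w → ⟦ Y w ⟧ * D) ⟩
        sum (λ w → ⟦ highDegree D w ⟧ * card X) + sum (λ w → ⟦ Y w ⟧ * D)
          ≡⟨ cong₂ _+_ (*-distribʳ-sum (card X) (⟦_⟧ ∘ highDegree D)) (*-distribʳ-sum D (⟦_⟧ ∘ Y)) ⟨
        card (highDegree D) * card X + card Y * D
          ∎
        where
        open ≤-Reasoning
        pointwise : ∀ w → ⟦ Y w ⟧ * redDegree red X w ≤ ⟦ highDegree D w ⟧ * card X + ⟦ Y w ⟧ * D
        pointwise w = by-cases (Y w) (D ≤? redDegree red X w)
          where
          by-cases : ∀ b (d : Dec (D ≤ redDegree red X w)) →
                     ⟦ b ⟧ * redDegree red X w ≤ ⟦ b ∧ does d ⟧ * card X + ⟦ b ⟧ * D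
          by-cases false _ = z≤n
          by-cases true (yes _) = ≤-trans (+-monoˡ-≤ 0 (redDegree≤card w)) (m≤m+n (card X + 0) (D + 0))
          by-cases true (no D≰degree) = +-monoˡ-≤ 0 (<⇒≤ (≰⇒> D≰degree))

      dense⇒inducedKtt : ∀ p q → 0 < p → L * p ≤ q → q ^ (4 * t) ≤ card Y * p ^ (4 * t) → card Y ≤ card X →
                         p * card X * card Y < sum (λ w → ⟦ Y w ⟧ * redDegree red X w) * q →
                         HasInducedRedKtt red t
      dense⇒inducedKtt p q p>0 Lp≤q y-large y≤x dense = inducedKtt (highDegree D) (highDegree⊆Y D) (proj₁ drc) (proj₂ drc)
        where
        q>0 : 0 < q
        q>0 = <-≤-trans p>0 (≤-trans (m≤n*m p L) Lp≤q)
        instance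
          2q≢0 : NonZero (2 * q)
          2q≢0 = >-nonZero (*-monoʳ-< 2 q>0)
        D : ℕ
        D = p * card X / (2 * q)
        D-bounds : D * (2 * q) ≤ p * card X × p * card X < suc D * (2 * q)
        D-bounds = floor-division (p * card X) (2 * q)
        open DensityBounds t′ p q (card X) (card Y) p>0 Lp≤q y-large y≤x using (drc-condition)
        open DependentRandomChoice red X (highDegree D) (t + t) t′ m using (goodNbhd; dependentRandomChoice)
        drc : ∃[ T ] m < card (goodNbhd T)
        drc = dependentRandomChoice D (highDegree-min D)
                (drc-condition D (proj₁ D-bounds) (proj₂ D-bounds) (card (highDegree D)) _
                   (card-mono (highDegree⊆Y D)) (∑redDegree-≤ D) dense)

    module _ (t′ p q : ℕ) (noKtt : ¬ HasInducedRedKtt red (suc t′)) (p>0 : 0 < p) (Lp≤q : L * p ≤ q) where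

      sparse-ordered : ∀ (A B : Subset n) → DisjointSets A B →
                       ¬ HasRedClique red A (suc t′) → ¬ HasRedClique red B (suc t′) →
                       q ^ (4 * suc t′) ≤ ∣ B ∣ * p ^ (4 * suc t′) → ∣ B ∣ ≤ ∣ A ∣ →
                       eR red A B * q ≤ p * (∣ A ∣ * ∣ B ∣)
      sparse-ordered A B A∩B≡∅ noRedA noRedB B-large B≤A = ≮⇒≥ λ dense →
        noKtt (dense⇒inducedKtt t′ (lookup A) (lookup B)
                 (λ x Ax Bx → A∩B≡∅ x (lookup⇒[]= x A Ax) (lookup⇒[]= x B Bx))
                 (noRedClique A noRedA) (noRedClique B noRedB) p q p>0 Lp≤q
                 (subst (λ b → q ^ (4 * suc t′) ≤ b * p ^ (4 * suc t′)) (∣∣≡card B) B-large)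
                 (subst₂ _≤_ (∣∣≡card B) (∣∣≡card A) B≤A)
                 (in-counts dense))
        where
        in-counts : p * (∣ A ∣ * ∣ B ∣) < eR red A B * q →
                    p * card (lookup A) * card (lookup B) < sum (λ w → ⟦ lookup B w ⟧ * redDegree red (lookup A) w) * q
        in-counts dense = begin-strict
          p * card (lookup A) * card (lookup B)                           ≡⟨ *-assoc p _ _ ⟩
          p * (card (lookup A) * card (lookup B))
            ≡⟨ cong₂ (λ a b → p * (a * b)) (∣∣≡card A) (∣∣≡card B) ⟨
          p * (∣ A ∣ * ∣ B ∣)                                             <⟨ dense ⟩
          eR red A B * q                                                  ≡⟨ cong (_* q) (eR≡∑redDegree red A B) ⟩
          sum (λ w → ⟦ lookup B w ⟧ * redDegree red (lookup A) w) * q     ∎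
          where open ≤-Reasoning

      sparse : ∀ (A B : Subset n) → DisjointSets A B →
               ¬ HasRedClique red A (suc t′) → ¬ HasRedClique red B (suc t′) →
               q ^ (4 * suc t′) ≤ ∣ A ∣ * p ^ (4 * suc t′) → q ^ (4 * suc t′) ≤ ∣ B ∣ * p ^ (4 * suc t′) →
               eR red A B * q ≤ p * (∣ A ∣ * ∣ B ∣)
      sparse A B A∩B≡∅ noRedA noRedB A-large B-large with ≤-total ∣ B ∣ ∣ A ∣
      ... | inj₁ B≤A = sparse-ordered A B A∩B≡∅ noRedA noRedB B-large B≤A
      ... | inj₂ A≤B = subst₂ (λ e ab → e * q ≤ p * ab) (eR-comm red red-sym B A) (*-comm ∣ B ∣ ∣ A ∣)
                         (sparse-ordered B A (λ x Bx Ax → A∩B≡∅ x Ax Bx) noRedB noRedA A-large A≤B)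

module RationalPowers where

  open import Data.Nat as ℕ using (ℕ; zero; suc; _^_)
  import Data.Nat.Properties as ℕ
  open import Data.Integer as ℤ using (+_; +≤+)
  import Data.Integer.Properties as ℤ
  open import Data.Rational using (ℚ; 1ℚ; _*_; _≤_; toℚᵘ)
  open import Data.Rational.Properties using (toℚᵘ-homo-*; toℚᵘ-mono-≤; toℚᵘ-cancel-≤; toℚᵘ-fromℚᵘ)
  open import Data.Rational.Unnormalised.Base as ℚᵘ using (ℚᵘ; mkℚᵘ; _≃_; *≤*)
  import Data.Rational.Unnormalised.Properties as ℚᵘ
  open import Relation.Binary.PropositionalEquality

  module Fraction (u v : ℕ) (δ : ℚ) (δ≡u/[1+v] : toℚᵘ δ ≡ mkℚᵘ (+ u) v) where

    ℕtoℚᵘ : ℕ → ℚᵘ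
    ℕtoℚᵘ x = mkℚᵘ (+ x) 0

    toℚᵘ-ℕtoℚ : ∀ x → toℚᵘ (ℕtoℚ x) ≃ ℕtoℚᵘ x
    toℚᵘ-ℕtoℚ x = toℚᵘ-fromℚᵘ (ℕtoℚᵘ x)

    -- (1 + v)^k − 1, defined so that suc ([1+v]^-1 (suc k)) reduces to (1 + v) * suc ([1+v]^-1 k),
    -- the denominator that ℚᵘ multiplication produces.
    [1+v]^-1 : ℕ → ℕ
    [1+v]^-1 zero = 0
    [1+v]^-1 (suc k) = [1+v]^-1 k ℕ.+ v ℕ.* suc ([1+v]^-1 k)

    suc-[1+v]^-1 : ∀ k → suc ([1+v]^-1 k) ≡ suc v ^ k
    suc-[1+v]^-1 zero = refl
    suc-[1+v]^-1 (suc k) = cong (suc v ℕ.*_) (suc-[1+v]^-1 k)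

    δ^ᵘ : ℕ → ℚᵘ
    δ^ᵘ k = mkℚᵘ (+ (u ^ k)) ([1+v]^-1 k)

    toℚᵘ-δ^ : ∀ k → toℚᵘ (δ ^ℚ k) ≃ δ^ᵘ k
    toℚᵘ-δ^ zero = ℚᵘ.≃-refl
    toℚᵘ-δ^ (suc k) = ℚᵘ.≃-trans (toℚᵘ-homo-* δ (δ ^ℚ k))
      (ℚᵘ.≃-trans (ℚᵘ.*-cong (ℚᵘ.≃-reflexive δ≡u/[1+v]) (toℚᵘ-δ^ k))
        (ℚᵘ.≃-reflexive (cong (λ n → mkℚᵘ n ([1+v]^-1 (suc k))) (sym (ℤ.pos-* u (u ^ k))))))

    1≤δ^k*x⇒[1+v]^k≤x*u^k : ∀ k x → 1ℚ ≤ δ ^ℚ k * ℕtoℚ x → suc v ^ k ℕ.≤ x ℕ.* u ^ k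
    1≤δ^k*x⇒[1+v]^k≤x*u^k k x 1≤δ^k*x
      with ℚᵘ.≤-respʳ-≃ (ℚᵘ.≃-trans (toℚᵘ-homo-* (δ ^ℚ k) (ℕtoℚ x)) (ℚᵘ.*-cong (toℚᵘ-δ^ k) (toℚᵘ-ℕtoℚ x)))
                        (toℚᵘ-mono-≤ 1≤δ^k*x)
    ... | *≤* le = subst₂ ℕ._≤_ (trans (cong suc (ℕ.*-identityʳ _)) (suc-[1+v]^-1 k)) (ℕ.*-comm (u ^ k) x)
                     (ℤ.drop‿+≤+ (subst₂ ℤ._≤_ (ℤ.*-identityˡ _) (trans (ℤ.*-identityʳ _) (sym (ℤ.pos-* (u ^ k) x))) le))

    e*[1+v]^k≤u^k*ab⇒e≤δ^k*ab : ∀ k a b e → e ℕ.* suc v ^ k ℕ.≤ u ^ k ℕ.* (a ℕ.* b) → ℕtoℚ e ≤ δ ^ℚ k * (ℕtoℚ a * ℕtoℚ b)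
    e*[1+v]^k≤u^k*ab⇒e≤δ^k*ab k a b e le =
      toℚᵘ-cancel-≤ (ℚᵘ.≤-respʳ-≃ (ℚᵘ.≃-sym product) (ℚᵘ.≤-respˡ-≃ (ℚᵘ.≃-sym (toℚᵘ-ℕtoℚ e)) (*≤* cross)))
      where
      product : toℚᵘ (δ ^ℚ k * (ℕtoℚ a * ℕtoℚ b)) ≃ δ^ᵘ k ℚᵘ.* (ℕtoℚᵘ a ℚᵘ.* ℕtoℚᵘ b)
      product = ℚᵘ.≃-trans (toℚᵘ-homo-* (δ ^ℚ k) (ℕtoℚ a * ℕtoℚ b))
                  (ℚᵘ.*-cong (toℚᵘ-δ^ k) (ℚᵘ.≃-trans (toℚᵘ-homo-* (ℕtoℚ a) (ℕtoℚ b)) (ℚᵘ.*-cong (toℚᵘ-ℕtoℚ a) (toℚᵘ-ℕtoℚ b))))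
      cross : + e ℤ.* + suc ([1+v]^-1 k ℕ.* 1) ℤ.≤ (+ (u ^ k) ℤ.* (+ a ℤ.* + b)) ℤ.* + 1
      cross = subst₂ ℤ._≤_ (ℤ.pos-* e _)
                (trans (ℤ.pos-* (u ^ k) (a ℕ.* b)) (trans (cong (+ (u ^ k) ℤ.*_) (ℤ.pos-* a b)) (sym (ℤ.*-identityʳ _))))
                (+≤+ (subst (λ d → e ℕ.* d ℕ.≤ _) (sym (trans (cong suc (ℕ.*-identityʳ _)) (suc-[1+v]^-1 k))) le))

open import Data.Nat using (ℕ; _>_) renaming (_*_ to _*ℕ_)
open import Data.Rational using (ℚ; 0ℚ; 1ℚ; ½; _<_; _≤_; _*_)
open import Data.Fin.Subset using (Subset; ∣_∣)
open import Data.Product using (Σ; _×_; ∃-syntax)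
open import Relation.Nullary using (¬_)
import Data.Nat as ℕ
import Data.Nat.Properties as ℕ
open import Data.Integer using (+_; +[1+_]; -[1+_]; +<+)
import Data.Integer.Properties as ℤ
open import Data.Rational using (mkℚ; *<*)
open import Data.Product using (_,_)
open import Relation.Binary.PropositionalEquality using (refl; subst₂)

redDensity≤δ^20 : ∀ (δ : ℚ) (t n : ℕ) (red : Colouring n) (A B : Subset n) →
                  0ℚ < δ → δ < ½ → t > 0 → Symmetric red → ¬ HasInducedRedKtt red t → DisjointSets A B →
                  ¬ HasRedClique red A t → ¬ HasRedClique red B t →
                  1ℚ ≤ (δ ^ℚ (80 *ℕ t)) * ℕtoℚ ∣ A ∣ → 1ℚ ≤ (δ ^ℚ (80 *ℕ t)) * ℕtoℚ ∣ B ∣ →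
                  ℕtoℚ (eR red A B) ≤ (δ ^ℚ 20) * (ℕtoℚ ∣ A ∣ * ℕtoℚ ∣ B ∣)
redDensity≤δ^20 (mkℚ (+ 0) _ _) _ _ _ _ _ (*<* (+<+ ()))
redDensity≤δ^20 (mkℚ -[1+ _ ] _ _) _ _ _ _ _ (*<* ())
redDensity≤δ^20 (mkℚ +[1+ _ ] _ _) ℕ.zero _ _ _ _ _ _ ()
redDensity≤δ^20 δ@(mkℚ +[1+ u ] v _) t@(ℕ.suc t′) _ red A B _ (*<* δ<½) _ red-sym noKtt A∩B≡∅ noRedA noRedB A-large B-large =
  e*[1+v]^k≤u^k*ab⇒e≤δ^k*ab 20 ∣ A ∣ ∣ B ∣ (eR red A B)
    (InducedBipartite.sparse red red-sym t′ (ℕ.suc u ℕ.^ 20) (ℕ.suc v ℕ.^ 20) noKtt (ℕ.m^n>0 (ℕ.suc u) 20)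
      (L*a^20≤b^20 {ℕ.suc u} {ℕ.suc v} 2[1+u]≤1+v)
      A B A∩B≡∅ noRedA noRedB (size-bound ∣ A ∣ A-large) (size-bound ∣ B ∣ B-large))
  where
  open RationalPowers.Fraction (ℕ.suc u) v δ refl
  open Arithmetic using (L*a^20≤b^20; a^[80t]≡[a^20]^[4t])
  2[1+u]≤1+v : 2 ℕ.* ℕ.suc u ℕ.≤ ℕ.suc v
  2[1+u]≤1+v = subst₂ ℕ._≤_ (ℕ.*-comm (ℕ.suc u) 2) (ℕ.*-identityˡ (ℕ.suc v)) (ℕ.<⇒≤ (ℤ.drop‿+<+ δ<½))
  size-bound : ∀ x → 1ℚ ≤ δ ^ℚ (80 *ℕ t) * ℕtoℚ x →
               (ℕ.suc v ℕ.^ 20) ℕ.^ (4 ℕ.* t) ℕ.≤ x ℕ.* (ℕ.suc u ℕ.^ 20) ℕ.^ (4 ℕ.* t)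
  size-bound x large = subst₂ (λ l r → l ℕ.≤ x ℕ.* r) (a^[80t]≡[a^20]^[4t] (ℕ.suc v) t) (a^[80t]≡[a^20]^[4t] (ℕ.suc u) t)
                           (1≤δ^k*x⇒[1+v]^k≤x*u^k (80 *ℕ t) x large)

lemma6 : ∃[ C′ ] (C′ > 0 ×
           (∀ (δ : ℚ) (t n : ℕ) (red : Colouring n) (A B : Subset n) →
             0ℚ < δ → δ < ½ → t > 0 →
             Symmetric red →
             ¬ HasInducedRedKtt red t →
             DisjointSets A B →
             ¬ HasRedClique red A t →
             ¬ HasRedClique red B t →
             1ℚ ≤ (δ ^ℚ (C′ *ℕ t)) * ℕtoℚ ∣ A ∣ →
             1ℚ ≤ (δ ^ℚ (C′ *ℕ t)) * ℕtoℚ ∣ B ∣ →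
             ℕtoℚ (eR red A B) ≤ (δ ^ℚ 20) * (ℕtoℚ ∣ A ∣ * ℕtoℚ ∣ B ∣)))
lemma6 = 80 , ℕ.s≤s ℕ.z≤n , redDensity≤δ^20
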